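{- Let $n \geq 30$. Consider the Zeckendorf game on $n$ with $6$ players divided into $3$ teams, each consisting of exactly $2$ consecutive players. Then no team has a winning strategy.
   Context: Let $F_1=1$, $F_2=2$, $F_{i+1}=F_i+F_{i-1}$. The Zeckendorf game on $n$ starts with the multiset of $n$ copies of $1$. A move is one of: if the list contains $F_{i-1}$ and $F_i$, replace them by $F_{i+1}$; if the list contains two copies of $F_i$: for $i=1$ replace them by $F_2$; for $i=2$ replace them by $F_1,F_3$; for $i\geq 3$ replace them by $F_{i-2},F_{i+1}$. The game ends when the list is the Zeckendorf decomposition of $n$ (distinct, pairwise non-consecutive Fibonacci numbers); every game terminates. With $p$ players, players $1,\dots,p$ move in cyclic order $1,2,\dots,p,1,2,\dots$ starting with player 1; players $i$ and $i+1 \pmod p$ are consecutive (so $p$ and $1$ are consecutive). A team wins if the final move is made by one of its members; it has a winning strategy if its members can choose their moves so that the final move is made by a member no matter what moves the other players make. -}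

module Defs where

open import Data.Nat using (ℕ; zero; suc; pred; _+_; _∸_; _≤_; _≡ᵇ_)
open import Data.Nat.DivMod using (_%_)
open import Data.Bool using (if_then_else_)
open import Data.Fin using (Fin; toℕ)
open import Data.Product using (_×_)
open import Data.Sum using (_⊎_)
open import Relation.Binary.PropositionalEquality using (_≡_)
open import Relation.Nullary using (¬_)

-- Fibonacci numbers with F₁ = 1, F₂ = 2, F_{i+1} = F_i + F_{i-1}
-- (F₀ = 1 is an auxiliary value making the recursion uniform; index 0 is never used).
fib : ℕ → ℕ
fib zero = 1
fib (suc zero) = 1
fib (suc (suc zero)) = 2
fib (suc (suc (suc i))) = fib (suc (suc i)) + fib (suc i)

-- A game position: a finite multiset of Fibonacci numbers F_i (i ≥ 1),
-- represented by its multiplicity function:  c i = number of copies of F_i.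
-- (Since F₁ < F₂ < F₃ < … are distinct, this is the same as a multiset of
-- Fibonacci numbers.)  Index 0 is unused (always 0 in reachable positions).
Counts : Set
Counts = ℕ → ℕ

inc : ℕ → Counts → Counts
inc i c j = if j ≡ᵇ i then suc (c j) else c j

dec : ℕ → Counts → Counts
dec i c j = if j ≡ᵇ i then pred (c j) else c j

data Move (c c' : Counts) : Set where
  combine : (i : ℕ) → 2 ≤ i → 1 ≤ c (pred i) → 1 ≤ c i →
            (∀ j → c' j ≡ inc (suc i) (dec i (dec (pred i) c)) j) → Move c c'
  split1  : 2 ≤ c 1 →
            (∀ j → c' j ≡ inc 2 (dec 1 (dec 1 c)) j) → Move c c'
  split2  : 2 ≤ c 2 →
            (∀ j → c' j ≡ inc 3 (inc 1 (dec 2 (dec 2 c))) j) → Move c c'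
  splitk  : (i : ℕ) → 3 ≤ i → 2 ≤ c i →
            (∀ j → c' j ≡ inc (suc i) (inc (i ∸ 2) (dec i (dec i c))) j) → Move c c'

-- The list is a Zeckendorf decomposition: distinct, pairwise non-consecutive
-- Fibonacci numbers.  (The sum is invariant under moves, so it equals n.)
IsZeckendorf : Counts → Set
IsZeckendorf c = (∀ i → c i ≤ 1) × (∀ i → c i ≡ 1 → c (suc i) ≡ 0)

start : ℕ → Counts
start n j = if j ≡ᵇ 1 then n else 0

-- Six players 0,…,5 (paper's players 1,…,6); move number t (t = 0,1,2,…)
-- is made by player t % 6.
-- Win T s t : the team T (a set of players) can force that the final move is
-- made by a member of T, from position s when t moves have been made so far.
-- (Inductive = well-founded game trees; fine since every game terminates.)
data Win (T : ℕ → Set) : Counts → ℕ → Set where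
  over   : ∀ {s t} → IsZeckendorf s → 1 ≤ t → T ((t + 5) % 6) → Win T s t
  ours   : ∀ {s t} s' → ¬ IsZeckendorf s → T (t % 6) → Move s s' →
           Win T s' (suc t) → Win T s t
  theirs : ∀ {s t} → ¬ IsZeckendorf s → ¬ T (t % 6) →
           (∀ s' → Move s s' → Win T s' (suc t)) → Win T s t

HasWinningStrategy : (ℕ → Set) → ℕ → Set
HasWinningStrategy T n = Win T (start n) 0

ConsecTeam : Fin 6 → ℕ → Set
ConsecTeam i p = (p ≡ toℕ i) ⊎ (p ≡ suc (toℕ i) % 6)

{-# OPTIONS --safe #-}
-- Let the four opponents of a consecutive team always play 2F₁ ↦ F₂.  Whatever the team
-- does, lower bounds on the number of F₁'s and on the weights ψ = s₁ + 2s₂ + s₃ and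
-- φ = 2s₂ + s₃, and an upper bound on s₃, hold up to the first time t ≥ 12 at which the four
-- opponents move in a row; n ≥ 30 is what makes the bounds last that long.  At that time one
-- of four Fibonacci identities (2F₁ + 2F₂ = 2F₃, 2F₁ + F₃ = F₄, 3F₂ = F₁ + F₄, F₂ + F₃ = F₄)
-- can be carried out by the opponents both in k and in k + 2 moves, so the team would have to
-- win from one and the same position both at time t + k and at time t + k + 2.  No two turns
-- of a consecutive team lie two apart, so these two strategies could be played against each
-- other, which is absurd.
module Submission where

open import Defs
open import Data.Nat
open import Data.Nat.Properties
open import Data.Nat.DivMod using (_%_; %-distribˡ-+)
open import Data.Bool using (true; false; T; if_then_else_)
open import Data.Fin using (Fin; toℕ)
open import Data.Fin.Properties using (all?)
open import Data.Product using (Σ-syntax; ∃; ∃-syntax; _×_; _,_; proj₁; proj₂)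
open import Data.Sum using (_⊎_; inj₁; inj₂)
open import Data.Unit using (⊤; tt)
open import Relation.Nullary using (¬_; Dec; yes; no; contradiction)
open import Relation.Nullary.Decidable
  using (map′; True; toWitness; from-yes; from-no; _×-dec_; _⊎-dec_; ¬?)
open import Relation.Binary.PropositionalEquality
open import Function using (_∘_)
open import Data.Nat.Tactic.RingSolver using (solve-∀)

-- Moves and valid positions

split₁ split₂ split₃ merge₁₂ merge₂₃ : Counts → Counts
split₁ s = inc 2 (dec 1 (dec 1 s))
merge₁₂ s = inc 3 (dec 2 (dec 1 s))
merge₂₃ s = inc 4 (dec 3 (dec 2 s))
split₂ s = inc 3 (inc 1 (dec 2 (dec 2 s)))
split₃ s = inc 4 (inc 1 (dec 3 (dec 3 s)))

split₁-move : ∀ {s} → 2 ≤ s 1 → Move s (split₁ s)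
split₁-move h = split1 h λ _ → refl

merge₁₂-move : ∀ {s} → 1 ≤ s 1 → 1 ≤ s 2 → Move s (merge₁₂ s)
merge₁₂-move h₁ h₂ = combine 2 (s≤s (s≤s z≤n)) h₁ h₂ λ _ → refl

merge₂₃-move : ∀ {s} → 1 ≤ s 2 → 1 ≤ s 3 → Move s (merge₂₃ s)
merge₂₃-move h₂ h₃ = combine 3 (s≤s (s≤s z≤n)) h₂ h₃ λ _ → refl

split₂-move : ∀ {s} → 2 ≤ s 2 → Move s (split₂ s)
split₂-move h = split2 h λ _ → refl

split₃-move : ∀ {s} → 2 ≤ s 3 → Move s (split₃ s)
split₃-move h = splitk 3 (s≤s (s≤s (s≤s z≤n))) h λ _ → refl

move-resp : ∀ {s u v} → Move s u → v ≗ u → Move s v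
move-resp (combine i 2≤i h₁ h₂ eq) v≗u = combine i 2≤i h₁ h₂ λ j → trans (v≗u j) (eq j)
move-resp (split1 h eq) v≗u = split1 h λ j → trans (v≗u j) (eq j)
move-resp (split2 h eq) v≗u = split2 h λ j → trans (v≗u j) (eq j)
move-resp (splitk i 3≤i h eq) v≗u = splitk i 3≤i h λ j → trans (v≗u j) (eq j)

if-≢ : ∀ {A : Set} {i j} {x y : A} → j ≢ i → (if j ≡ᵇ i then x else y) ≡ y
if-≢ {i = i} {j} j≢i with j ≡ᵇ i in eq
... | true  = contradiction (≡ᵇ⇒≡ j i (subst T (sym eq) tt)) j≢i
... | false = refl

if-beyond : ∀ {A : Set} {i j m} {x y : A} → 2 + i ≤ j → m ≤ 1 + i → (if j ≡ᵇ m then x else y) ≡ y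
if-beyond i+2≤j m≤1+i = if-≢ (>⇒≢ (≤-trans (s≤s m≤1+i) i+2≤j))

-- Index 0 is not a Fibonacci index, and without a finite support a position could be
-- stuck without being Zeckendorf, hence a vacuous win for every team.
Valid : Counts → Set
Valid s = s 0 ≡ 0 × ∃[ N ] (∀ j → N ≤ j → s j ≡ 0)

move-local : ∀ {s s'} → Move s s' →
             ∃[ i ] 1 ≤ s i × s' 0 ≡ s 0 × (∀ j → 2 + i ≤ j → s' j ≡ s j)
move-local (combine 0 () _ _ _)
move-local (combine 1 (s≤s ()) _ _ _)
move-local (combine i@(suc (suc _)) _ _ h eq) = i , h , eq 0 , λ j far →
  trans (eq j) (trans (if-beyond far ≤-refl)
               (trans (if-beyond far (n≤1+n i))
                      (if-beyond far (m≤n⇒m≤1+n (n≤1+n _)))))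
move-local (split1 h eq) = 1 , ≤-trans (n≤1+n 1) h , eq 0 , λ j far →
  trans (eq j) (trans (if-beyond far ≤-refl)
               (trans (if-beyond far (n≤1+n 1)) (if-beyond far (n≤1+n 1))))
move-local (split2 h eq) = 2 , ≤-trans (n≤1+n 1) h , eq 0 , λ j far →
  trans (eq j) (trans (if-beyond far ≤-refl) (trans (if-beyond far (s≤s z≤n))
               (trans (if-beyond far (n≤1+n 2)) (if-beyond far (n≤1+n 2)))))
move-local (splitk 0 () _ _)
move-local (splitk 1 (s≤s ()) _ _)
move-local (splitk 2 (s≤s (s≤s ())) _ _)
move-local (splitk i@(suc (suc (suc _))) _ h eq) = i , ≤-trans (n≤1+n 1) h , eq 0 , λ j far →
  trans (eq j) (trans (if-beyond far ≤-refl)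
               (trans (if-beyond far (m≤n⇒m≤1+n (m≤n⇒m≤1+n (n≤1+n _))))
               (trans (if-beyond far (n≤1+n i)) (if-beyond far (n≤1+n i)))))

move-valid : ∀ {s s'} → Valid s → Move s s' → Valid s'
move-valid {s} (s₀≡0 , N , vanish) mv with move-local mv
... | i , 1≤sᵢ , same₀ , same-beyond = trans same₀ s₀≡0 , suc N , λ j N<j →
  trans (same-beyond j (≤-trans (s≤s i<N) N<j)) (vanish j (≤-trans (n≤1+n N) N<j))
  where
  i<N : i < N
  i<N with N ≤? i
  ... | yes N≤i = contradiction (vanish i N≤i) (>⇒≢ 1≤sᵢ)
  ... | no  N≰i = ≰⇒> N≰i

Overfull : Counts → ℕ → Set
Overfull s i = 2 ≤ s i ⊎ (1 ≤ s i × 1 ≤ s (suc i))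

overfull? : ∀ s i → Dec (Overfull s i)
overfull? s i = (2 ≤? s i) ⊎-dec ((1 ≤? s i) ×-dec (1 ≤? s (suc i)))

overfull⇒occupied : ∀ {s i} → Overfull s i → 1 ≤ s i
overfull⇒occupied (inj₁ 2≤sᵢ) = ≤-trans (n≤1+n 1) 2≤sᵢ
overfull⇒occupied (inj₂ (1≤sᵢ , _)) = 1≤sᵢ

¬overfull⇒zeckendorf : ∀ {s} → (∀ i → ¬ Overfull s i) → IsZeckendorf s
¬overfull⇒zeckendorf ¬over =
    (λ i → ≤-pred (≰⇒> (¬over i ∘ inj₁)))
  , (λ i sᵢ≡1 → n<1⇒n≡0 (≰⇒> λ 1≤sᵢ₊₁ → ¬over i (inj₂ (≤-reflexive (sym sᵢ≡1) , 1≤sᵢ₊₁))))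

overfull⇒move : ∀ {s i} → s 0 ≡ 0 → Overfull s i → ∃ (Move s)
overfull⇒move {s} {0} s₀≡0 full = contradiction s₀≡0 (>⇒≢ (overfull⇒occupied {s} full))
overfull⇒move {i = 1} _ (inj₁ h) = _ , split₁-move h
overfull⇒move {i = 2} _ (inj₁ h) = _ , split₂-move h
overfull⇒move {i = i@(suc (suc (suc _)))} _ (inj₁ h) = _ , splitk i (s≤s (s≤s (s≤s z≤n))) h λ _ → refl
overfull⇒move {i = suc i} _ (inj₂ (h , h')) = _ , combine (2 + i) (s≤s (s≤s z≤n)) h h' λ _ → refl

valid⇒move : ∀ {s} → Valid s → ¬ IsZeckendorf s → ∃ (Move s)
valid⇒move {s} (s₀≡0 , N , vanish) ¬zeck with anyUpTo? (overfull? s) N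
... | yes (i , _ , full) = overfull⇒move s₀≡0 full
... | no ¬over = contradiction (¬overfull⇒zeckendorf ¬overᵢ) ¬zeck
  where
  ¬overᵢ : ∀ i → ¬ Overfull s i
  ¬overᵢ i full with i <? N
  ... | yes i<N = ¬over (i , i<N , full)
  ... | no  i≮N = contradiction (vanish i (≮⇒≥ i≮N)) (>⇒≢ (overfull⇒occupied {s} full))

move⇒¬zeckendorf : ∀ {s s'} → Move s s' → ¬ IsZeckendorf s
move⇒¬zeckendorf (combine (suc (suc _)) _ h h' _) (atMostOne , isolated) =
  contradiction (isolated _ (≤-antisym (atMostOne _) h)) (>⇒≢ h')
move⇒¬zeckendorf (combine 1 (s≤s ()) _ _ _)
move⇒¬zeckendorf (split1 h _) (atMostOne , _) = <⇒≱ h (atMostOne 1)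
move⇒¬zeckendorf (split2 h _) (atMostOne , _) = <⇒≱ h (atMostOne 2)
move⇒¬zeckendorf (splitk i _ h _) (atMostOne , _) = <⇒≱ h (atMostOne i)


-- Playing against a shifted clock

opponent-move : ∀ {T s s' t} → ¬ T (t % 6) → Move s s' → Win T s t → Win T s' (suc t)
opponent-move _ mv (over zeck _ _) = contradiction zeck (move⇒¬zeckendorf mv)
opponent-move ¬own _ (ours _ _ own _ _) = contradiction own ¬own
opponent-move _ mv (theirs _ _ reply) = reply _ mv

own-move : ∀ {T s t} → T (t % 6) → ¬ IsZeckendorf s → Win T s t → ∃[ s' ] Move s s' × Win T s' (suc t)
own-move _ ¬zeck (over zeck _ _) = contradiction zeck ¬zeck
own-move _ _ (ours s' _ _ mv win) = s' , mv , win
own-move own _ (theirs _ ¬own _) = contradiction own ¬own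

record Exclusive (T : ℕ → Set) (a b : ℕ) : Set where
  constructor exclusive
  field apart : ∀ p → T ((a + p) % 6) → ¬ T ((b + p) % 6)
open Exclusive

exclusive-suc : ∀ {T a b} → Exclusive T a b → Exclusive T (suc a) (suc b)
exclusive-suc {T} {a} {b} excl = exclusive λ p own₁ own₂ →
  apart excl (suc p) (subst (λ m → T (m % 6)) (sym (+-suc a p)) own₁)
                     (subst (λ m → T (m % 6)) (sym (+-suc b p)) own₂)

exclusive-now : ∀ {T a b} → Exclusive T a b → T (a % 6) → ¬ T (b % 6)
exclusive-now {T} {a} {b} excl own₁ own₂ =
  apart excl 0 (subst (λ m → T (m % 6)) (sym (+-identityʳ a)) own₁)
               (subst (λ m → T (m % 6)) (sym (+-identityʳ b)) own₂)

-- The game tree below s does not depend on the clock, and at every node at most one of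
-- the two clocks gives T the move, so T's two strategies can be played against each other.
¬both-win : ∀ {T s a b} → Exclusive T a b → Valid s → Win T s a → ¬ Win T s b
¬both-win excl _ (over _ _ own₁) (over _ _ own₂) = apart excl 5 own₁ own₂
¬both-win _ _ (over zeck _ _) (ours _ ¬zeck _ _ _) = ¬zeck zeck
¬both-win _ _ (over zeck _ _) (theirs ¬zeck _ _) = ¬zeck zeck
¬both-win _ _ (ours _ ¬zeck _ _ _) (over zeck _ _) = ¬zeck zeck
¬both-win _ _ (theirs ¬zeck _ _) (over zeck _ _) = ¬zeck zeck
¬both-win excl _ (ours _ _ own₁ _ _) (ours _ _ own₂ _ _) = exclusive-now excl own₁ own₂
¬both-win excl v (ours s' _ _ mv win₁) (theirs _ _ reply₂) =
  ¬both-win (exclusive-suc excl) (move-valid v mv) win₁ (reply₂ s' mv)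
¬both-win excl v (theirs _ _ reply₁) (ours s' _ _ mv win₂) =
  ¬both-win (exclusive-suc excl) (move-valid v mv) (reply₁ s' mv) win₂
¬both-win excl v (theirs ¬zeck _ reply₁) (theirs _ _ reply₂) with valid⇒move v ¬zeck
... | s' , mv = ¬both-win (exclusive-suc excl) (move-valid v mv) (reply₁ s' mv) (reply₂ s' mv)

consecTeam? : ∀ i p → Dec (ConsecTeam i p)
consecTeam? i p = (p ≟ toℕ i) ⊎-dec (p ≟ suc (toℕ i) % 6)

consecTeam-gap : ∀ i r → ConsecTeam i r → ¬ ConsecTeam i ((r + 2) % 6)
consecTeam-gap i _ (inj₁ refl) = from-yes (all? λ i → ¬? (consecTeam? i ((toℕ i + 2) % 6))) i
consecTeam-gap i _ (inj₂ refl) = from-yes (all? λ i → ¬? (consecTeam? i ((suc (toℕ i) % 6 + 2) % 6))) i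

consecTeam-exclusive : ∀ i a → Exclusive (ConsecTeam i) a (2 + a)
consecTeam-exclusive i a = exclusive λ p own₁ own₂ →
  consecTeam-gap i _ own₁ (subst (ConsecTeam i) (trans (cong (_% 6) (+-comm 2 (a + p)))
                                                        (%-distribˡ-+ (a + p) 2 6)) own₂)


-- Transpositions

infixr 5 _∷_

data Moves : ℕ → Counts → Counts → Set where
  []  : ∀ {s} → Moves 0 s s
  _∷_ : ∀ {k s s' u} → Move s s' → Moves k s' u → Moves (suc k) s u

moves-valid : ∀ {k s u} → Valid s → Moves k s u → Valid u
moves-valid v [] = v
moves-valid v (mv ∷ mvs) = moves-valid (move-valid v mv) mvs

OpponentTurns : (ℕ → Set) → ℕ → ℕ → Set
OpponentTurns T t zero = ⊤
OpponentTurns T t (suc k) = ¬ T (t % 6) × OpponentTurns T (suc t) k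

opponentTurns? : ∀ {T} → (∀ p → Dec (T p)) → ∀ t k → Dec (OpponentTurns T t k)
opponentTurns? T? t zero = yes tt
opponentTurns? T? t (suc k) = ¬? (T? (t % 6)) ×-dec opponentTurns? T? (suc t) k

opponentTurns-≤ : ∀ {T t k m} → k ≤ m → OpponentTurns T t m → OpponentTurns T t k
opponentTurns-≤ z≤n _ = tt
opponentTurns-≤ (s≤s k≤m) (¬own , turns) = ¬own , opponentTurns-≤ k≤m turns

forced : ∀ {T t k s u} → OpponentTurns T t k → Moves k s u → Win T s t → Win T u (k + t)
forced _ [] win = win
forced {T} {t} {suc k} {u = u} (¬own , turns) (mv ∷ mvs) win =
  subst (Win T u) (+-suc k t) (forced turns mvs (opponent-move ¬own mv win))

Transposition : ℕ → Counts → Set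
Transposition k s = ∃[ u ] Moves k s u × Moves (2 + k) s u

transposition⇒¬win : ∀ {T t k s} → (∀ a → Exclusive T a (2 + a)) → Valid s →
                     Transposition k s → OpponentTurns T t (2 + k) → ¬ Win T s t
transposition⇒¬win excl v (u , short , long) turns win =
  ¬both-win (excl _) (moves-valid v short)
    (forced (opponentTurns-≤ (m≤n+m _ 2) turns) short win) (forced turns long win)

transposition₁₂ : ∀ {s a b} → s 1 ≡ 3 + a → s 2 ≡ 2 + b → Transposition 2 s
transposition₁₂ {s} s₁ s₂ =
  merge₁₂ (merge₁₂ s) ,
  merge₁₂-move h₁ h₂ ∷ merge₁₂-move h₃ h₄ ∷ [] ,
  split₁-move h₅ ∷ split₂-move h₆ ∷ split₁-move h₇ ∷ move-resp (split₂-move h₈) same ∷ []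
  where
  h₁ : 1 ≤ s 1
  h₁ rewrite s₁ = s≤s z≤n
  h₂ : 1 ≤ s 2
  h₂ rewrite s₂ = s≤s z≤n
  h₃ : 1 ≤ merge₁₂ s 1
  h₃ rewrite s₁ = s≤s z≤n
  h₄ : 1 ≤ merge₁₂ s 2
  h₄ rewrite s₂ = s≤s z≤n
  h₅ : 2 ≤ s 1
  h₅ rewrite s₁ = s≤s (s≤s z≤n)
  h₆ : 2 ≤ split₁ s 2
  h₆ = s≤s h₂
  h₇ : 2 ≤ split₂ (split₁ s) 1
  h₇ rewrite s₁ = s≤s (s≤s z≤n)
  h₈ : 2 ≤ split₁ (split₂ (split₁ s)) 2
  h₈ rewrite s₂ = s≤s (s≤s z≤n)
  same : merge₁₂ (merge₁₂ s) ≗ split₂ (split₁ (split₂ (split₁ s)))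
  same 0 = refl
  same 1 rewrite s₁ = refl
  same 2 rewrite s₂ = refl
  same 3 = refl
  same (suc (suc (suc (suc j)))) = refl

transposition₁₃ : ∀ {s a c} → s 1 ≡ 4 + a → s 3 ≡ 1 + c → Transposition 2 s
transposition₁₃ {s} s₁ s₃ =
  merge₂₃ (split₁ s) ,
  split₁-move h₁ ∷ merge₂₃-move (s≤s z≤n) h₂ ∷ [] ,
  split₁-move h₁ ∷ split₁-move h₃ ∷ split₂-move (s≤s (s≤s z≤n)) ∷ move-resp (split₃-move h₄) same ∷ []
  where
  h₁ : 2 ≤ s 1
  h₁ rewrite s₁ = s≤s (s≤s z≤n)
  h₂ : 1 ≤ split₁ s 3
  h₂ rewrite s₃ = s≤s z≤n
  h₃ : 2 ≤ split₁ s 1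
  h₃ rewrite s₁ = s≤s (s≤s z≤n)
  h₄ : 2 ≤ split₂ (split₁ (split₁ s)) 3
  h₄ rewrite s₃ = s≤s (s≤s z≤n)
  same : merge₂₃ (split₁ s) ≗ split₃ (split₂ (split₁ (split₁ s)))
  same 0 = refl
  same 1 rewrite s₁ = refl
  same 2 = refl
  same 3 = refl
  same 4 = refl
  same (suc (suc (suc (suc (suc j))))) = refl

transposition₂ : ∀ {s b} → s 2 ≡ 4 + b → Transposition 2 s
transposition₂ {s} s₂ =
  merge₂₃ (split₂ s) ,
  split₂-move h₁ ∷ merge₂₃-move h₂ (s≤s z≤n) ∷ [] ,
  split₂-move h₁ ∷ split₂-move h₃ ∷ split₃-move (s≤s (s≤s z≤n)) ∷
    move-resp (split₁-move (s≤s (s≤s z≤n))) same ∷ []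
  where
  h₁ : 2 ≤ s 2
  h₁ rewrite s₂ = s≤s (s≤s z≤n)
  h₂ : 1 ≤ split₂ s 2
  h₂ rewrite s₂ = s≤s z≤n
  h₃ : 2 ≤ split₂ s 2
  h₃ rewrite s₂ = s≤s (s≤s z≤n)
  same : merge₂₃ (split₂ s) ≗ split₁ (split₃ (split₂ (split₂ s)))
  same 0 = refl
  same 1 = refl
  same 2 rewrite s₂ = refl
  same 3 = refl
  same 4 = refl
  same (suc (suc (suc (suc (suc j))))) = refl

transposition₂₃ : ∀ {s b c} → s 2 ≡ 2 + b → s 3 ≡ 1 + c → Transposition 1 s
transposition₂₃ {s} s₂ s₃ =
  merge₂₃ s ,
  merge₂₃-move h₁ h₂ ∷ [] ,
  split₂-move h₃ ∷ split₃-move h₄ ∷ move-resp (split₁-move (s≤s (s≤s z≤n))) same ∷ []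
  where
  h₁ : 1 ≤ s 2
  h₁ rewrite s₂ = s≤s z≤n
  h₂ : 1 ≤ s 3
  h₂ rewrite s₃ = s≤s z≤n
  h₃ : 2 ≤ s 2
  h₃ rewrite s₂ = s≤s (s≤s z≤n)
  h₄ : 2 ≤ split₂ s 3
  h₄ rewrite s₃ = s≤s (s≤s z≤n)
  same : merge₂₃ s ≗ split₁ (split₃ (split₂ s))
  same 0 = refl
  same 1 = refl
  same 2 rewrite s₂ = refl
  same 3 = refl
  same 4 = refl
  same (suc (suc (suc (suc (suc j))))) = refl


-- Summands F₁, F₂, F₃

record Triple : Set where
  constructor ⟨_,_,_⟩
  field one two three : ℕ
open Triple

infixl 6 _⊕_
infix 7 _·_

_⊕_ : Triple → Triple → Triple
⟨ a , b , c ⟩ ⊕ ⟨ x , y , z ⟩ = ⟨ a + x , b + y , c + z ⟩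

_·_ : Triple → Triple → ℕ
⟨ a , b , c ⟩ · ⟨ x , y , z ⟩ = a * x + b * y + c * z

·-distribˡ-⊕ : ∀ w x y → w · (x ⊕ y) ≡ w · x + w · y
·-distribˡ-⊕ ⟨ a , b , c ⟩ ⟨ x , y , z ⟩ ⟨ x' , y' , z' ⟩ = lemma a b c x y z x' y' z'
  where
  lemma : ∀ a b c x y z x' y' z' → a * (x + x') + b * (y + y') + c * (z + z')
                                  ≡ (a * x + b * y + c * z) + (a * x' + b * y' + c * z')
  lemma = solve-∀

·-monoʳ-≤ : ∀ w {x y z x' y' z'} → x ≤ x' → y ≤ y' → z ≤ z' → w · ⟨ x , y , z ⟩ ≤ w · ⟨ x' , y' , z' ⟩
·-monoʳ-≤ ⟨ a , b , c ⟩ x≤ y≤ z≤ =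
  +-mono-≤ (+-mono-≤ (*-monoʳ-≤ a x≤) (*-monoʳ-≤ b y≤)) (*-monoʳ-≤ c z≤)

⟨⟩-cong : ∀ {x x' y y' z z'} → x ≡ x' → y ≡ y' → z ≡ z' → ⟨ x , y , z ⟩ ≡ ⟨ x' , y' , z' ⟩
⟨⟩-cong refl refl refl = refl

low : Counts → Triple
low s = ⟨ s 1 , s 2 , s 3 ⟩

record Exchange (r a : Triple) (s s' : Counts) : Set where
  constructor exchange
  field balance : a ⊕ low s ≡ r ⊕ low s'
open Exchange

exchange-resp : ∀ {r a s u s'} → s' ≗ u → Exchange r a s u → Exchange r a s s'
exchange-resp {r} s'≗u ex =
  exchange (trans (balance ex) (cong (r ⊕_) (sym (⟨⟩-cong (s'≗u 1) (s'≗u 2) (s'≗u 3)))))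

·-exchange : ∀ w {r a s s'} → Exchange r a s s' → w · a + w · low s ≡ w · r + w · low s'
·-exchange w {r} {a} {s} {s'} ex = begin
  w · a + w · low s   ≡⟨ ·-distribˡ-⊕ w a (low s) ⟨
  w · (a ⊕ low s)     ≡⟨ cong (w ·_) (balance ex) ⟩
  w · (r ⊕ low s')    ≡⟨ ·-distribˡ-⊕ w r (low s') ⟩
  w · r + w · low s'  ∎
  where open ≡-Reasoning

exchange-≤ : ∀ {a x r y} c → a + x ≡ r + y → r ≤ c + a → x ≤ c + y
exchange-≤ {a} {x} {r} {y} c a+x≡r+y r≤c+a = +-cancelˡ-≤ a x (c + y) (begin
  a + x        ≡⟨ a+x≡r+y ⟩
  r + y        ≤⟨ +-monoˡ-≤ y r≤c+a ⟩
  c + a + y    ≡⟨ cong (_+ y) (+-comm c a) ⟩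
  a + c + y    ≡⟨ +-assoc a c y ⟩
  a + (c + y)  ∎)
  where open ≤-Reasoning

-- ψ is at most 4 on Zeckendorf positions; the opponents' 2F₁ ↦ F₂ keeps ψ and raises φ by 2,
-- while no move lowers either by more than 3.
ψ φ : Triple
ψ = ⟨ 1 , 2 , 1 ⟩
φ = ⟨ 0 , 2 , 1 ⟩

zeckendorf⇒ψ≤4 : ∀ {s} → IsZeckendorf s → ψ · low s ≤ 4
zeckendorf⇒ψ≤4 (atMostOne , _) = ·-monoʳ-≤ ψ (atMostOne 1) (atMostOne 2) (atMostOne 3)

record Mild (r a : Triple) : Set where
  constructor mild-by
  field
    ones-drop   : one r ≤ 2 + one a
    ψ-drop      : ψ · r ≤ 3 + ψ · a
    φ-drop      : φ · r ≤ 3 + φ · a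
    threes-rise : three a ≤ 1 + three r
open Mild

mild? : ∀ r a → Dec (Mild r a)
mild? r a = map′ (λ (p , q , u , v) → mild-by p q u v)
                 (λ m → ones-drop m , ψ-drop m , φ-drop m , threes-rise m)
                 ((_ ≤? _) ×-dec (_ ≤? _) ×-dec (_ ≤? _) ×-dec (_ ≤? _))

mild : ∀ {r a} {_ : True (mild? r a)} → Mild r a
mild {_} {_} {checked} = toWitness checked

2+pred[pred[n]]≡n : ∀ {n} → 2 ≤ n → 2 + pred (pred n) ≡ n
2+pred[pred[n]]≡n (s≤s (s≤s _)) = refl

split₁-exchange : ∀ {s} → 2 ≤ s 1 → Exchange ⟨ 2 , 0 , 0 ⟩ ⟨ 0 , 1 , 0 ⟩ s (split₁ s)
split₁-exchange h = exchange (⟨⟩-cong (sym (2+pred[pred[n]]≡n h)) refl refl)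

move-exchange : ∀ {s s'} → Move s s' → Σ[ r ∈ Triple ] Σ[ a ∈ Triple ] Mild r a × Exchange r a s s'
move-exchange (combine 2 _ h₁ h₂ eq) = ⟨ 1 , 1 , 0 ⟩ , ⟨ 0 , 0 , 1 ⟩ , mild ,
  exchange-resp eq (exchange (⟨⟩-cong (sym (suc-pred _ {{>-nonZero h₁}}))
                                      (sym (suc-pred _ {{>-nonZero h₂}})) refl))
move-exchange (combine 3 _ h₂ h₃ eq) = ⟨ 0 , 1 , 1 ⟩ , ⟨ 0 , 0 , 0 ⟩ , mild ,
  exchange-resp eq (exchange (⟨⟩-cong refl (sym (suc-pred _ {{>-nonZero h₂}}))
                                           (sym (suc-pred _ {{>-nonZero h₃}}))))
move-exchange (combine 4 _ h₃ _ eq) = ⟨ 0 , 0 , 1 ⟩ , ⟨ 0 , 0 , 0 ⟩ , mild ,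
  exchange-resp eq (exchange (⟨⟩-cong refl refl (sym (suc-pred _ {{>-nonZero h₃}}))))
move-exchange (combine (suc (suc (suc (suc (suc _))))) _ _ _ eq) =
  ⟨ 0 , 0 , 0 ⟩ , ⟨ 0 , 0 , 0 ⟩ , mild , exchange-resp eq (exchange refl)
move-exchange (split1 h eq) = ⟨ 2 , 0 , 0 ⟩ , ⟨ 0 , 1 , 0 ⟩ , mild ,
  exchange-resp eq (split₁-exchange h)
move-exchange (split2 h eq) = ⟨ 0 , 2 , 0 ⟩ , ⟨ 1 , 0 , 1 ⟩ , mild ,
  exchange-resp eq (exchange (⟨⟩-cong refl (sym (2+pred[pred[n]]≡n h)) refl))
move-exchange (splitk 3 _ h eq) = ⟨ 0 , 0 , 2 ⟩ , ⟨ 1 , 0 , 0 ⟩ , mild ,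
  exchange-resp eq (exchange (⟨⟩-cong refl refl (sym (2+pred[pred[n]]≡n h))))
move-exchange (splitk 4 _ _ eq) = ⟨ 0 , 0 , 0 ⟩ , ⟨ 0 , 1 , 0 ⟩ , mild , exchange-resp eq (exchange refl)
move-exchange (splitk 5 _ _ eq) = ⟨ 0 , 0 , 0 ⟩ , ⟨ 0 , 0 , 1 ⟩ , mild , exchange-resp eq (exchange refl)
move-exchange (splitk (suc (suc (suc (suc (suc (suc _)))))) _ _ eq) =
  ⟨ 0 , 0 , 0 ⟩ , ⟨ 0 , 0 , 0 ⟩ , mild , exchange-resp eq (exchange refl)
move-exchange (combine 1 (s≤s ()) _ _ _)
move-exchange (splitk 1 (s≤s ()) _ _)
move-exchange (splitk 2 (s≤s (s≤s ())) _ _)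


-- Budgets

record Budget : Set where
  constructor budget
  field min-ones min-ψ min-φ max-threes : ℕ
open Budget

record Within (b : Budget) (s : Counts) : Set where
  field
    valid    : Valid s
    ones≥    : min-ones b ≤ s 1
    ψ≥       : min-ψ b ≤ ψ · low s
    φ≥       : min-φ b ≤ φ · low s
    threes≤  : s 3 ≤ max-threes b
open Within

after-move after-split₁ : Budget → Budget
after-move (budget d p f c) = budget (d ∸ 2) (p ∸ 3) (f ∸ 3) (suc c)
after-split₁ (budget d p f c) = budget (d ∸ 2) p (2 + f) c

within-after-move : ∀ {b s s'} → Within b s → Move s s' → Within (after-move b) s'
within-after-move {b} {s} {s'} w mv with move-exchange mv
... | r , a , m , ex = record
  { valid   = move-valid (valid w) mv
  ; ones≥   = m≤n+o⇒m∸n≤o _ 2 (≤-trans (ones≥ w) (exchange-≤ 2 (cong one (balance ex)) (ones-drop m)))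
  ; ψ≥      = m≤n+o⇒m∸n≤o _ 3 (≤-trans (ψ≥ w) (exchange-≤ 3 (·-exchange ψ ex) (ψ-drop m)))
  ; φ≥      = m≤n+o⇒m∸n≤o _ 3 (≤-trans (φ≥ w) (exchange-≤ 3 (·-exchange φ ex) (φ-drop m)))
  ; threes≤ = ≤-trans (exchange-≤ 1 (sym (cong three (balance ex))) (threes-rise m)) (s≤s (threes≤ w))
  }

within-after-split₁ : ∀ {b s} → Within b s → (h : 2 ≤ s 1) → Within (after-split₁ b) (split₁ s)
within-after-split₁ {b} {s} w h = record
  { valid   = move-valid (valid w) (split₁-move h)
  ; ones≥   = m≤n+o⇒m∸n≤o _ 2 (≤-trans (ones≥ w) (≤-reflexive (cong one (balance ex))))
  ; ψ≥      = ≤-trans (ψ≥ w) (≤-reflexive (+-cancelˡ-≡ 2 _ _ (·-exchange ψ ex)))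
  ; φ≥      = ≤-trans (+-monoʳ-≤ 2 (φ≥ w)) (≤-reflexive (·-exchange φ ex))
  ; threes≤ = threes≤ w
  }
  where
  ex : Exchange ⟨ 2 , 0 , 0 ⟩ ⟨ 0 , 1 , 0 ⟩ s (split₁ s)
  ex = split₁-exchange h


-- The opponents' strategy

n≡m+[n∸m] : ∀ {m n} → m ≤ n → n ≡ m + (n ∸ m)
n≡m+[n∸m] m≤n = sym (m+[n∸m]≡n m≤n)

endgame-transposition : ∀ {s} → 12 ≤ ψ · low s → 3 ≤ φ · low s → s 3 ≤ 6 →
                        ∃[ k ] k ≤ 2 × Transposition k s
endgame-transposition {s} ψ≥12 φ≥3 s₃≤6 with 4 ≤? s 2 | 2 ≤? s 2 | 1 ≤? s 3
... | yes 4≤s₂ | _ | _ = 2 , ≤-refl , transposition₂ (n≡m+[n∸m] 4≤s₂)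
... | no _ | yes 2≤s₂ | yes 1≤s₃ = 1 , s≤s z≤n , transposition₂₃ (n≡m+[n∸m] 2≤s₂) (n≡m+[n∸m] 1≤s₃)
... | no s₂≱4 | yes 2≤s₂ | no s₃≱1 with 3 ≤? s 1
...   | yes 3≤s₁ = 2 , ≤-refl , transposition₁₂ (n≡m+[n∸m] 3≤s₁) (n≡m+[n∸m] 2≤s₂)
...   | no s₁≱3 = contradiction (≤-trans ψ≥12 (·-monoʳ-≤ ψ (≮⇒≥ s₁≱3) (≮⇒≥ s₂≱4) (≮⇒≥ s₃≱1)))
                                (from-no (12 ≤? 8))
endgame-transposition {s} ψ≥12 φ≥3 s₃≤6 | no _ | no s₂≱2 | no s₃≱1 =
  contradiction (≤-trans φ≥3 (·-monoʳ-≤ φ (≤-refl {s 1}) (≮⇒≥ s₂≱2) (≮⇒≥ s₃≱1))) (from-no (3 ≤? 2))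
endgame-transposition {s} ψ≥12 φ≥3 s₃≤6 | no _ | no s₂≱2 | yes 1≤s₃ with 4 ≤? s 1
... | yes 4≤s₁ = 2 , ≤-refl , transposition₁₃ (n≡m+[n∸m] 4≤s₁) (n≡m+[n∸m] 1≤s₃)
... | no s₁≱4 = contradiction (≤-trans ψ≥12 (·-monoʳ-≤ ψ (≮⇒≥ s₁≱4) (≮⇒≥ s₂≱2) s₃≤6))
                              (from-no (12 ≤? 11))

Survives : ∀ {T : ℕ → Set} → (∀ p → Dec (T p)) → ℕ → ℕ → Budget → Set
Survives {T} T? zero t b = OpponentTurns T t 4 × 12 ≤ min-ψ b × 3 ≤ min-φ b × max-threes b ≤ 6
Survives T? (suc k) t b with T? (t % 6)
... | yes _ = 5 ≤ min-ψ b × Survives T? k (suc t) (after-move b)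
... | no _  = 2 ≤ min-ones b × Survives T? k (suc t) (after-split₁ b)

survives? : ∀ {T : ℕ → Set} (T? : ∀ p → Dec (T p)) k t b → Dec (Survives T? k t b)
survives? T? zero t b = opponentTurns? T? t 4 ×-dec (12 ≤? _) ×-dec (3 ≤? _) ×-dec (_ ≤? 6)
survives? T? (suc k) t b with T? (t % 6)
... | yes _ = (5 ≤? min-ψ b) ×-dec survives? T? k (suc t) (after-move b)
... | no _  = (2 ≤? min-ones b) ×-dec survives? T? k (suc t) (after-split₁ b)

survives⇒¬win : ∀ {T : ℕ → Set} (T? : ∀ p → Dec (T p)) → (∀ a → Exclusive T a (2 + a)) →
                ∀ {k t b s} → Survives T? k t b → Within b s → ¬ Win T s t
survives⇒¬win T? excl {zero} (turns , ψ≥12 , φ≥3 , threes≤6) w win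
  with endgame-transposition (≤-trans ψ≥12 (ψ≥ w)) (≤-trans φ≥3 (φ≥ w)) (≤-trans (threes≤ w) threes≤6)
... | k , k≤2 , transposition =
  transposition⇒¬win excl (valid w) transposition (opponentTurns-≤ (s≤s (s≤s k≤2)) turns) win
survives⇒¬win T? excl {suc k} {t} sv w win with T? (t % 6)
... | yes own with own-move own (λ zeck → <⇒≱ (≤-trans (proj₁ sv) (ψ≥ w)) (zeckendorf⇒ψ≤4 zeck)) win
...   | s' , mv , win' = survives⇒¬win T? excl {k} (proj₂ sv) (within-after-move w mv) win'
survives⇒¬win T? excl {suc k} {t} {b} {s} (ones≥2 , sv) w win | no ¬own =
  survives⇒¬win T? excl {k} sv (within-after-split₁ w s₁≥2) (opponent-move ¬own (split₁-move s₁≥2) win)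
  where
  s₁≥2 : 2 ≤ s 1
  s₁≥2 = ≤-trans ones≥2 (ones≥ w)

initial : Budget
initial = budget 30 30 0 0

start-within : ∀ {n} → 30 ≤ n → Within initial (start n)
start-within {n} 30≤n = record
  { valid   = refl , 2 , λ { (suc (suc j)) _ → refl ; 1 (s≤s ()) }
  ; ones≥   = 30≤n
  ; ψ≥      = ≤-trans 30≤n (≤-trans (m≤m+n n 0) (≤-trans (m≤m+n (n + 0) 0) (m≤m+n (n + 0 + 0) 0)))
  ; φ≥      = z≤n
  ; threes≤ = z≤n
  }

-- The first time from 12 on at which the four opponents of team i move in a row.
endgameTime : Fin 6 → ℕ
endgameTime i = 12 + (2 + toℕ i) % 6

schedule : ∀ i → Survives (consecTeam? i) (endgameTime i) 0 initial
schedule = from-yes (all? {P = λ i → Survives (consecTeam? i) (endgameTime i) 0 initial}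
                            λ i → survives? (consecTeam? i) (endgameTime i) 0 initial)

lemma2p2p2 : (n : ℕ) → 30 ≤ n → (i : Fin 6) → ¬ HasWinningStrategy (ConsecTeam i) n
lemma2p2p2 n 30≤n i =
  survives⇒¬win (consecTeam? i) (consecTeam-exclusive i) (schedule i) (start-within 30≤n)
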